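{- Let $q$ be a prime power, $F_q$ the field with $q$ elements, $V=F_q^n$, and $1<k<n-1$. Let $S$ be a $(k-1)$-dimensional subspace of $V$ having a generator matrix of the form $M=[I_{k-1}\ A]$, where $I_{k-1}$ is the $(k-1)\times(k-1)$ identity matrix and $A$ is a $(k-1)\times(n-k+1)$ matrix over $F_q$. Let $W$ be the set of all vectors $w\in V$ whose first $k-1$ coordinates are $0$ and such that the matrix obtained by appending $w$ as a last row to $M$ generates a $k$-dimensional projective code. If $\dim\langle W\rangle>2$, then $[S\rangle^{\Pi}_{k}$ is a star of $\Pi[n,k]_q$, i.e. a maximal clique of $\Pi[n,k]_q$.
   Context: A linear code $[n,k]_q$ is a $k$-dimensional subspace of $V=F_q^n$; a generator matrix is a matrix whose rows form a basis of it. A code is projective if the columns of a generator matrix are non-zero and pairwise non-proportional. $\Pi(n,k)_q$ denotes the set of all $k$-dimensional projective codes in $V$, and $\Pi[n,k]_q$ is the simple graph with vertex set $\Pi(n,k)_q$ in which two distinct codes are adjacent iff their intersection is $(k-1)$-dimensional. A clique is a set of pairwise adjacent vertices; it is maximal if not properly contained in another clique. $[S\rangle^{\Pi}_{k}$ denotes the set of all elements of $\Pi(n,k)_q$ containing $S$; it is called a star of $\Pi[n,k]_q$ if it is a maximal clique of $\Pi[n,k]_q$. -}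

module Defs where

open import Level using (Level; _⊔_; suc)
open import Algebra.Bundles using (CommutativeRing)
open import Data.Nat.Base using (ℕ; _∸_; _<_)
import Data.Nat.Base as ℕ
open import Data.Fin.Base using (Fin; toℕ; fromℕ)
open import Data.Fin.Base as Fin using ()
open import Data.Product using (Σ; Σ-syntax; ∃; ∃-syntax; _×_; _,_)
open import Relation.Nullary using (¬_; Dec)
open import Relation.Binary.PropositionalEquality using (_≡_)
open import Relation.Binary.Definitions using (Decidable)

record IsFiniteField {c ℓ} (F : CommutativeRing c ℓ) (q : ℕ) : Set (c ⊔ ℓ) where
  open CommutativeRing F
  field
    0≉1     : ¬ (0# ≈ 1#)
    inverse : ∀ x → ¬ (x ≈ 0#) → ∃[ y ] (x * y ≈ 1#)
    _≟_     : Decidable _≈_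
    enum    : Fin q → Carrier
    enum-injective  : ∀ i j → enum i ≈ enum j → i ≡ j
    enum-surjective : ∀ x → ∃[ i ] (enum i ≈ x)

module Codes {c ℓ} (F : CommutativeRing c ℓ) (n : ℕ) where
  open CommutativeRing F
  open import Algebra.Definitions.RawMonoid +-rawMonoid using (sum)

  Vec : Set c
  Vec = Fin n → Carrier

  Mat : ℕ → Set c
  Mat m = Fin m → Vec

  _≈v_ : Vec → Vec → Set ℓ
  u ≈v v = ∀ j → u j ≈ v j

  zeroV : Vec
  zeroV _ = 0#

  lincomb : ∀ {m} → (Fin m → Carrier) → Mat m → Vec
  lincomb a G j = sum (λ i → a i * G i j)

  LinIndep : ∀ {m} → Mat m → Set (c ⊔ ℓ)
  LinIndep {m} G = ∀ (a : Fin m → Carrier) → lincomb a G ≈v zeroV → ∀ i → a i ≈ 0#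

  InSpan : ∀ {m} → Mat m → Vec → Set (c ⊔ ℓ)
  InSpan {m} G v = ∃[ a ] (v ≈v lincomb a G)

  _⊆span_ : ∀ {m m'} → Mat m → Mat m' → Set (c ⊔ ℓ)
  G ⊆span H = ∀ v → InSpan G v → InSpan H v

  SameSpan : ∀ {m m'} → Mat m → Mat m' → Set (c ⊔ ℓ)
  SameSpan G H = (G ⊆span H) × (H ⊆span G)

  col : ∀ {m} → Mat m → Fin n → (Fin m → Carrier)
  col G j i = G i j

  Projective : ∀ {m} → Mat m → Set (c ⊔ ℓ)
  Projective {m} G =
    (∀ j → ¬ (∀ i → col G j i ≈ 0#)) ×
    (∀ j j' → ¬ (j ≡ j') → ¬ (∃[ λ' ] (∀ i → col G j i ≈ λ' * col G j' i)))

  GeneratesProjCode : ∀ {m} → ℕ → Mat m → Set (c ⊔ ℓ)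
  GeneratesProjCode k G = Σ[ B ∈ Mat k ] (LinIndep B × Projective B × SameSpan B G)

  -- the vertex set Π(n,k)_q: k-dimensional projective codes, each given
  -- by a generator matrix (two vertices are the same code iff SameSpan)
  record ProjCode (k : ℕ) : Set (c ⊔ ℓ) where
    constructor mkCode
    field
      gen      : Mat k
      indep    : LinIndep gen
      proj     : Projective gen
  open ProjCode public

  SameCode : ∀ {k} → ProjCode k → ProjCode k → Set (c ⊔ ℓ)
  SameCode X Y = SameSpan (gen X) (gen Y)

  IntersectionDim : ∀ {m m'} → ℕ → Mat m → Mat m' → Set (c ⊔ ℓ)
  IntersectionDim d G H =
    Σ[ B ∈ Mat d ] (LinIndep B ×
      (∀ v → InSpan B v → InSpan G v × InSpan H v) ×
      (∀ v → InSpan G v → InSpan H v → InSpan B v))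

  Adjacent : ∀ {k} → ProjCode k → ProjCode k → Set (c ⊔ ℓ)
  Adjacent {k} X Y = ¬ SameCode X Y × IntersectionDim (k ∸ 1) (gen X) (gen Y)

  VSet : ℕ → Set (Level.suc (c ⊔ ℓ))
  VSet k = ProjCode k → Set (c ⊔ ℓ)

  IsClique : ∀ {k} → VSet k → Set (c ⊔ ℓ)
  IsClique {k} C = ∀ (X Y : ProjCode k) → C X → C Y → ¬ SameCode X Y → Adjacent X Y

  IsMaximalClique : ∀ {k} → VSet k → Set (Level.suc (c ⊔ ℓ))
  IsMaximalClique {k} C =
    IsClique C × (∀ (D : VSet k) → IsClique D → (∀ X → C X → D X) → ∀ X → D X → C X)

  Star : ∀ {m} → (k : ℕ) → Mat m → VSet k
  Star k M X = M ⊆span gen X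

  IdentityPrefix : (k : ℕ) → Mat (k ∸ 1) → Set ℓ
  IdentityPrefix k M =
    ∀ (i : Fin (k ∸ 1)) (j : Fin n) → toℕ j < k ∸ 1 →
      (toℕ i ≡ toℕ j → M i j ≈ 1#) × (¬ (toℕ i ≡ toℕ j) → M i j ≈ 0#)

  appendRow : ∀ {m} → Mat m → Vec → Mat (ℕ.suc m)
  appendRow {ℕ.zero}  M w Fin.zero    = w
  appendRow {ℕ.suc m} M w Fin.zero    = M Fin.zero
  appendRow {ℕ.suc m} M w (Fin.suc i) = appendRow (λ i' → M (Fin.suc i')) w i

  WSet : (k : ℕ) → Mat (k ∸ 1) → Vec → Set (c ⊔ ℓ)
  WSet k M w = (∀ j → toℕ j < k ∸ 1 → w j ≈ 0#) × GeneratesProjCode k (appendRow M w)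

  InSpanOf : (Vec → Set (c ⊔ ℓ)) → Vec → Set (c ⊔ ℓ)
  InSpanOf P v = ∃[ m ] Σ[ U ∈ Mat m ] ((∀ i → P (U i)) × InSpan U v)

  DimSpanGreaterThan2 : (Vec → Set (c ⊔ ℓ)) → Set (c ⊔ ℓ)
  DimSpanGreaterThan2 P = Σ[ B ∈ Mat 3 ] (LinIndep B × (∀ i → InSpanOf P (B i)))

module Submission where

-- Two codes of the star meeting outside S = ⟨M⟩ in some v would both have
-- the basis (v, M), so distinct codes of the star meet exactly in S.
-- For maximality, let Z be adjacent to every code of the star without
-- containing S.  For w ∈ W the star code ⟨w, S⟩ meets Z in a (k-1)-space
-- which is not S, so some y ∈ Z ∩ ⟨w, S⟩ lies outside S, whence w ∈ ⟨y, S⟩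
-- ⊆ Z + S.  Fixing one w₀ ∈ W, Z ⊆ ⟨z, w₀, S⟩ for a single z, so Z + S is
-- spanned by k + 1 vectors.  Yet it contains S and three independent vectors
-- of ⟨W⟩, which vanish on the identity columns of M: k + 2 independent
-- vectors, contradicting the Steinitz exchange lemma.

open import Defs
open import Algebra.Bundles using (CommutativeRing)
open import Data.Empty using (⊥-elim)
open import Data.Fin.Base using (Fin; zero; suc; toℕ; fromℕ; inject₁; inject≤; punchIn; splitAt; join; _↑ˡ_; _↑ʳ_)
open import Data.Fin.Properties using (punchInᵢ≢i; join-splitAt; toℕ-inject≤; toℕ<n; toℕ-injective; all?; any?; ¬∀⟶∃¬)
open import Data.Nat.Base as ℕ using (ℕ; zero; suc; _∸_; _<_)
open import Data.Nat.Properties using (≤-trans; n≤1+n; <⇒≤; m∸n≤m)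
open import Data.Product using (∃; ∃-syntax; Σ-syntax; _×_; _,_; proj₁; proj₂)
open import Data.Sum using (inj₁; inj₂; [_,_])
open import Data.Vec.Functional using (_∷_; _++_; removeAt)
open import Data.Vec.Functional.Properties using (lookup-++ˡ; lookup-++ʳ)
open import Function using (_∘_)
open import Level using (_⊔_)
open import Relation.Binary.Definitions using (Decidable)
open import Relation.Binary.PropositionalEquality as ≡ using (_≡_; _≢_)
open import Relation.Nullary using (¬_; Dec; yes; no)
open import Relation.Nullary.Decidable using (map′)

module LinearAlgebra {c ℓ} (F : CommutativeRing c ℓ) (n : ℕ) where
  open CommutativeRing F hiding (zero)
  open Codes F n
  open import Algebra.Properties.Semiring.Sum semiring
    using (sum; sum-remove; ∑-distrib-+; ∑-comm; *-distribˡ-sum; *-distribʳ-sum; sum-cong-≋; sum-replicate-zero)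
  open import Algebra.Properties.Ring ring using (-‿distribˡ-*)
  open import Relation.Binary.Reasoning.Setoid setoid

  sum-≈0 : ∀ {m} {f : Fin m → Carrier} → (∀ i → f i ≈ 0#) → sum f ≈ 0#
  sum-≈0 {m} f≈0 = trans (sum-cong-≋ f≈0) (sum-replicate-zero m)

  sum-splitAt : ∀ r {m} (f : Fin (r ℕ.+ m) → Carrier) →
    sum f ≈ sum (f ∘ (_↑ˡ m)) + sum (f ∘ (r ↑ʳ_))
  sum-splitAt zero    f = sym (+-identityˡ (sum f))
  sum-splitAt (suc r) f = trans (+-congˡ (sum-splitAt r (f ∘ suc))) (sym (+-assoc _ _ _))

  sum-δ : ∀ {m} (a g : Fin m → Carrier) {i} → g i ≈ 1# → (∀ i' → i' ≢ i → g i' ≈ 0#) →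
    sum (λ i' → a i' * g i') ≈ a i
  sum-δ {suc m} a g {i} gᵢ≈1 g≈0 = begin
    sum (λ i' → a i' * g i')                                ≈⟨ sum-remove (λ i' → a i' * g i') ⟩
    a i * g i + sum (λ i' → a (punchIn i i') * g (punchIn i i'))
      ≈⟨ +-cong (*-congˡ gᵢ≈1) (sum-≈0 (λ i' → trans (*-congˡ (g≈0 _ (punchInᵢ≢i i i'))) (zeroʳ _))) ⟩
    a i * 1# + 0#                                           ≈⟨ +-identityʳ _ ⟩
    a i * 1#                                                ≈⟨ *-identityʳ _ ⟩
    a i                                                     ∎

  lincomb-cong : ∀ {m} {a b : Fin m → Carrier} (G : Mat m) → (∀ i → a i ≈ b i) →
    lincomb a G ≈v lincomb b G
  lincomb-cong G a≈b j = sum-cong-≋ (λ i → *-congʳ (a≈b i))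

  lincomb-≈0 : ∀ {m} {a : Fin m → Carrier} (G : Mat m) → (∀ i → a i ≈ 0#) → lincomb a G ≈v zeroV
  lincomb-≈0 G a≈0 j = sum-≈0 (λ i → trans (*-congʳ (a≈0 i)) (zeroˡ _))

  lincomb-+-* : ∀ {m} (a b : Fin m → Carrier) x (G : Mat m) j →
    lincomb (λ i → a i + x * b i) G j ≈ lincomb a G j + x * lincomb b G j
  lincomb-+-* a b x G j = begin
    sum (λ i → (a i + x * b i) * G i j)                     ≈⟨ sum-cong-≋ (λ i → distribʳ (G i j) (a i) (x * b i)) ⟩
    sum (λ i → a i * G i j + x * b i * G i j)               ≈⟨ ∑-distrib-+ (λ i → a i * G i j) (λ i → x * b i * G i j) ⟩
    sum (λ i → a i * G i j) + sum (λ i → x * b i * G i j)   ≈⟨ +-congˡ (sum-cong-≋ (λ i → *-assoc x (b i) (G i j))) ⟩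
    sum (λ i → a i * G i j) + sum (λ i → x * (b i * G i j)) ≈⟨ +-congˡ (*-distribˡ-sum x (λ i → b i * G i j)) ⟨
    sum (λ i → a i * G i j) + x * sum (λ i → b i * G i j)   ∎

  lincomb-* : ∀ {m} (a : Fin m → Carrier) x (G : Mat m) j →
    lincomb (λ i → x * a i) G j ≈ x * lincomb a G j
  lincomb-* a x G j = begin
    sum (λ i → x * a i * G i j)   ≈⟨ sum-cong-≋ (λ i → *-assoc x (a i) (G i j)) ⟩
    sum (λ i → x * (a i * G i j)) ≈⟨ *-distribˡ-sum x (λ i → a i * G i j) ⟨
    x * sum (λ i → a i * G i j)   ∎

  lincomb-lincomb : ∀ {m m'} (a : Fin m → Carrier) (b : Fin m → Fin m' → Carrier) (G : Mat m') j →
    lincomb a (λ i → lincomb (b i) G) j ≈ lincomb (λ i' → sum (λ i → a i * b i i')) G j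
  lincomb-lincomb a b G j = begin
    sum (λ i → a i * sum (λ i' → b i i' * G i' j))       ≈⟨ sum-cong-≋ (λ i → *-distribˡ-sum (a i) (λ i' → b i i' * G i' j)) ⟩
    sum (λ i → sum (λ i' → a i * (b i i' * G i' j)))     ≈⟨ ∑-comm (λ i i' → a i * (b i i' * G i' j)) ⟩
    sum (λ i' → sum (λ i → a i * (b i i' * G i' j)))     ≈⟨ sum-cong-≋ (λ i' → sum-cong-≋ (λ i → *-assoc (a i) (b i i') (G i' j))) ⟨
    sum (λ i' → sum (λ i → a i * b i i' * G i' j))       ≈⟨ sum-cong-≋ (λ i' → *-distribʳ-sum (G i' j) (λ i → a i * b i i')) ⟨
    sum (λ i' → sum (λ i → a i * b i i') * G i' j)       ∎

  lincomb-++ : ∀ {r m} (a : Fin (r ℕ.+ m) → Carrier) (G : Mat r) (H : Mat m) j →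
    lincomb a (G ++ H) j ≈ lincomb (a ∘ (_↑ˡ m)) G j + lincomb (a ∘ (r ↑ʳ_)) H j
  lincomb-++ {r} {m} a G H j = trans (sum-splitAt r (λ i → a i * (G ++ H) i j))
    (+-cong (sum-cong-≋ (λ i → *-congˡ (reflexive (≡.cong (λ v → v j) (lookup-++ˡ G H i)))))
            (sum-cong-≋ (λ i → *-congˡ (reflexive (≡.cong (λ v → v j) (lookup-++ʳ G H i))))))

  lincomb-zeroColumn : ∀ {m} (a : Fin m → Carrier) (G : Mat m) {j} → (∀ i → G i j ≈ 0#) →
    lincomb a G j ≈ 0#
  lincomb-zeroColumn a G G≈0 = sum-≈0 (λ i → trans (*-congˡ (G≈0 i)) (zeroʳ _))

  InSpan-zeroColumn : ∀ {m} (G : Mat m) {j v} → (∀ i → G i j ≈ 0#) → InSpan G v → v j ≈ 0#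
  InSpan-zeroColumn G G≈0 (a , v≈) = trans (v≈ _) (lincomb-zeroColumn a G G≈0)

  InSpan-row : ∀ {m} (G : Mat m) i → InSpan G (G i)
  InSpan-row G zero = (1# ∷ λ _ → 0#) , λ j → sym (begin
    1# * G zero j + sum (λ i → 0# * G (suc i) j) ≈⟨ +-cong (*-identityˡ _) (sum-≈0 (λ i → zeroˡ (G (suc i) j))) ⟩
    G zero j + 0#                                 ≈⟨ +-identityʳ _ ⟩
    G zero j                                      ∎)
  InSpan-row G (suc i) with InSpan-row (G ∘ suc) i
  ... | a , Gᵢ≈ = (0# ∷ a) , λ j → trans (Gᵢ≈ j) (sym (trans (+-congʳ (zeroˡ _)) (+-identityˡ _)))

  lincomb-∷-head≈0 : ∀ {m} (a : Fin (suc m) → Carrier) v (G : Mat m) → a zero ≈ 0# →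
    lincomb a (v ∷ G) ≈v lincomb (a ∘ suc) G
  lincomb-∷-head≈0 a v G a₀≈0 j = trans (+-congʳ (trans (*-congʳ a₀≈0) (zeroˡ (v j)))) (+-identityˡ _)

  LinIndep-shear : ∀ {m} {U : Mat (suc m)} (t : Fin m → Carrier) → LinIndep U →
    LinIndep (λ i j → U (suc i) j + t i * U zero j)
  LinIndep-shear {U = U} t U-indep b b·U'≈0 i = U-indep (sum (λ i → b i * t i) ∷ b) a·U≈0 (suc i)
    where
      a·U≈0 : lincomb (sum (λ i → b i * t i) ∷ b) U ≈v zeroV
      a·U≈0 j = begin
        sum (λ i → b i * t i) * U zero j + sum (λ i → b i * U (suc i) j)
          ≈⟨ +-comm _ _ ⟩
        sum (λ i → b i * U (suc i) j) + sum (λ i → b i * t i) * U zero j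
          ≈⟨ +-congˡ (*-distribʳ-sum (U zero j) (λ i → b i * t i)) ⟩
        sum (λ i → b i * U (suc i) j) + sum (λ i → b i * t i * U zero j)
          ≈⟨ ∑-distrib-+ (λ i → b i * U (suc i) j) (λ i → b i * t i * U zero j) ⟨
        sum (λ i → b i * U (suc i) j + b i * t i * U zero j)
          ≈⟨ sum-cong-≋ (λ i → trans (+-congˡ (*-assoc (b i) (t i) (U zero j)))
                                     (sym (distribˡ (b i) (U (suc i) j) (t i * U zero j)))) ⟩
        lincomb b (λ i j → U (suc i) j + t i * U zero j) j
          ≈⟨ b·U'≈0 j ⟩
        0# ∎

  InSpan-eliminate : ∀ {m} (G : Mat (suc m)) j₀ {c e : Fin (suc m) → Carrier} {d u v} →
    d * c j₀ ≈ 1# → u ≈v lincomb c G → v ≈v lincomb e G →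
    InSpan (removeAt G j₀) (λ j → v j + - (e j₀ * d) * u j)
  InSpan-eliminate G j₀ {c} {e} {d} {u} {v} dc≈1 u≈ v≈ = removeAt f j₀ , λ j → begin
    v j + t * u j                                                  ≈⟨ +-cong (v≈ j) (*-congˡ (u≈ j)) ⟩
    lincomb e G j + t * lincomb c G j                              ≈⟨ lincomb-+-* e c t G j ⟨
    lincomb f G j                                                  ≈⟨ sum-remove {i = j₀} (λ i → f i * G i j) ⟩
    f j₀ * G j₀ j + lincomb (removeAt f j₀) (removeAt G j₀) j      ≈⟨ +-congʳ (trans (*-congʳ fⱼ₀≈0) (zeroˡ _)) ⟩
    0# + lincomb (removeAt f j₀) (removeAt G j₀) j                 ≈⟨ +-identityˡ _ ⟩
    lincomb (removeAt f j₀) (removeAt G j₀) j                      ∎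
    where
      t = - (e j₀ * d)
      f = λ i → e i + t * c i
      fⱼ₀≈0 : f j₀ ≈ 0#
      fⱼ₀≈0 = begin
        e j₀ + - (e j₀ * d) * c j₀   ≈⟨ +-congˡ (-‿distribˡ-* (e j₀ * d) (c j₀)) ⟨
        e j₀ + - (e j₀ * d * c j₀)   ≈⟨ +-congˡ (-‿cong (*-assoc (e j₀) d (c j₀))) ⟩
        e j₀ + - (e j₀ * (d * c j₀)) ≈⟨ +-congˡ (-‿cong (trans (*-congˡ dc≈1) (*-identityʳ (e j₀)))) ⟩
        e j₀ + - e j₀                ≈⟨ -‿inverseʳ (e j₀) ⟩
        0#                           ∎

  ⊆span-rows : ∀ {m m'} {G : Mat m} {H : Mat m'} → (∀ i → InSpan H (G i)) → G ⊆span H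
  ⊆span-rows {G = G} {H} G⊆H v (a , v≈) = _ , λ j → begin
    v j                                        ≈⟨ v≈ j ⟩
    lincomb a G j                              ≈⟨ sum-cong-≋ (λ i → *-congˡ (proj₂ (G⊆H i) j)) ⟩
    lincomb a (λ i → lincomb (b i) H) j        ≈⟨ lincomb-lincomb a b H j ⟩
    lincomb (λ i' → sum (λ i → a i * b i i')) H j ∎
    where
      b = λ i → proj₁ (G⊆H i)

  ⊆span-reindex : ∀ {m m'} {G : Mat m} {H : Mat m'} → (∀ i → ∃ λ i' → G i ≡ H i') → G ⊆span H
  ⊆span-reindex {H = H} G⊆H = ⊆span-rows λ i →
    ≡.subst (InSpan H) (≡.sym (proj₂ (G⊆H i))) (InSpan-row H (proj₁ (G⊆H i)))

  ⊆span-∷ : ∀ {m} {G : Mat m} {v} → G ⊆span (v ∷ G)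
  ⊆span-∷ {G = G} {v} = ⊆span-reindex {G = G} {H = v ∷ G} λ i → suc i , ≡.refl

  ∷-⊆span : ∀ {m m'} {G : Mat m} {H : Mat m'} {v} → InSpan H v → G ⊆span H → (v ∷ G) ⊆span H
  ∷-⊆span {G = G} {H} {v} v∈H G⊆H = ⊆span-rows {G = v ∷ G} {H = H} λ
    { zero    → v∈H
    ; (suc i) → G⊆H _ (InSpan-row G i) }

  ∷-mono-⊆span : ∀ {m m'} {G : Mat m} {H : Mat m'} {v} → G ⊆span H → (v ∷ G) ⊆span (v ∷ H)
  ∷-mono-⊆span {G = G} {H} {v} G⊆H = ⊆span-rows {G = v ∷ G} {H = v ∷ H} λ
    { zero    → InSpan-row (v ∷ H) zero
    ; (suc i) → ⊆span-∷ {G = H} {v} _ (G⊆H _ (InSpan-row G i)) }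

  ++-⊆span : ∀ {r m m'} {G : Mat r} {H : Mat m} {K : Mat m'} → G ⊆span K → H ⊆span K → (G ++ H) ⊆span K
  ++-⊆span {r} {G = G} {H} G⊆K H⊆K = ⊆span-rows row
    where
      row : ∀ i → InSpan _ ((G ++ H) i)
      row i with splitAt r i
      ... | inj₁ i' = G⊆K _ (InSpan-row G i')
      ... | inj₂ i' = H⊆K _ (InSpan-row H i')

  appendRow-row : ∀ {m} (M : Mat m) w i → ∃ λ i' → appendRow M w i ≡ (w ∷ M) i'
  appendRow-row {zero}  M w zero    = zero , ≡.refl
  appendRow-row {suc m} M w zero    = suc zero , ≡.refl
  appendRow-row {suc m} M w (suc i) with appendRow-row (M ∘ suc) w i
  ... | zero    , eq = zero , eq
  ... | suc i'  , eq = suc (suc i') , eq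

  appendRow-last : ∀ {m} (M : Mat m) w → appendRow M w (fromℕ m) ≡ w
  appendRow-last {zero}  M w = ≡.refl
  appendRow-last {suc m} M w = appendRow-last (M ∘ suc) w

  appendRow-inject₁ : ∀ {m} (M : Mat m) w i → appendRow M w (inject₁ i) ≡ M i
  appendRow-inject₁ {suc m} M w zero    = ≡.refl
  appendRow-inject₁ {suc m} M w (suc i) = appendRow-inject₁ (M ∘ suc) w i

  appendRow-SameSpan-∷ : ∀ {m} (M : Mat m) w → SameSpan (appendRow M w) (w ∷ M)
  appendRow-SameSpan-∷ {m} M w =
    ⊆span-reindex {G = appendRow M w} {H = w ∷ M} (appendRow-row M w) ,
    ⊆span-reindex {G = w ∷ M} {H = appendRow M w} λ
    { zero    → fromℕ m , ≡.sym (appendRow-last M w)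
    ; (suc i) → inject₁ i , ≡.sym (appendRow-inject₁ M w i) }

  IsUnitColumn : ∀ {m} → Mat m → Fin m → Fin n → Set ℓ
  IsUnitColumn M i j = M i j ≈ 1# × (∀ i' → i' ≢ i → M i' j ≈ 0#)

  lincomb-unitColumn : ∀ {m} {M : Mat m} {i j} → IsUnitColumn M i j → ∀ a → lincomb a M j ≈ a i
  lincomb-unitColumn {M = M} {j = j} (Mᵢⱼ≈1 , M≈0) a = sum-δ a (λ i' → M i' j) Mᵢⱼ≈1 M≈0

  unitColumns⇒LinIndep : ∀ {m} {M : Mat m} (p : Fin m → Fin n) → (∀ i → IsUnitColumn M i (p i)) →
    LinIndep M
  unitColumns⇒LinIndep {M = M} p unit a a·M≈0 i = trans (sym (lincomb-unitColumn {M = M} (unit i) a)) (a·M≈0 (p i))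

  LinIndep-++-unitColumns : ∀ {r m} {B : Mat r} {M : Mat m} (p : Fin m → Fin n) →
    (∀ i → IsUnitColumn M i (p i)) → LinIndep B → (∀ s i → B s (p i) ≈ 0#) → LinIndep (B ++ M)
  LinIndep-++-unitColumns {r} {m} {B} {M} p unit B-indep B≈0 a a·BM≈0 i =
    ≡.subst (λ i → a i ≈ 0#) (join-splitAt r m i)
      ([_,_] {C = λ s → a (join r m s) ≈ 0#} aᴮ≈0 aᴹ≈0 (splitAt r i))
    where
      aᴹ≈0 : ∀ i → a (r ↑ʳ i) ≈ 0#
      aᴹ≈0 i = begin
        a (r ↑ʳ i)                                                    ≈⟨ lincomb-unitColumn {M = M} (unit i) _ ⟨
        lincomb (a ∘ (r ↑ʳ_)) M (p i)                                 ≈⟨ +-identityˡ _ ⟨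
        0# + lincomb (a ∘ (r ↑ʳ_)) M (p i)                            ≈⟨ +-congʳ (lincomb-zeroColumn _ B (λ s → B≈0 s i)) ⟨
        lincomb (a ∘ (_↑ˡ m)) B (p i) + lincomb (a ∘ (r ↑ʳ_)) M (p i) ≈⟨ lincomb-++ a B M (p i) ⟨
        lincomb a (B ++ M) (p i)                                      ≈⟨ a·BM≈0 (p i) ⟩
        0#                                                            ∎
      aᴮ≈0 : ∀ i → a (i ↑ˡ m) ≈ 0#
      aᴮ≈0 = B-indep (a ∘ (_↑ˡ m)) λ j → begin
        lincomb (a ∘ (_↑ˡ m)) B j                               ≈⟨ +-identityʳ _ ⟨
        lincomb (a ∘ (_↑ˡ m)) B j + 0#                          ≈⟨ +-congˡ (lincomb-≈0 M aᴹ≈0 j) ⟨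
        lincomb (a ∘ (_↑ˡ m)) B j + lincomb (a ∘ (r ↑ʳ_)) M j   ≈⟨ lincomb-++ a B M j ⟨
        lincomb a (B ++ M) j                                    ≈⟨ a·BM≈0 j ⟩
        0#                                                      ∎

  -- X ⊇ ⟨M⟩ and X ⊆ ⟨w, M⟩ with dim X = m + 1 force X = ⟨w, M⟩: the code of the star through w
  ExtendsToStarCode : ∀ {m} → Mat m → Vec → Set (c ⊔ ℓ)
  ExtendsToStarCode {m} M w = Σ[ X ∈ ProjCode (suc m) ] (Star (suc m) M X × gen X ⊆span (w ∷ M))

  module OverField (_≟_ : Decidable _≈_) (0≉1 : ¬ 0# ≈ 1#)
                   (inverse : ∀ x → ¬ x ≈ 0# → ∃[ y ] x * y ≈ 1#) where

    inverseˡ : ∀ {x} → ¬ x ≈ 0# → ∃[ d ] d * x ≈ 1#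
    inverseˡ {x} x≉0 = proj₁ (inverse x x≉0) , trans (*-comm _ x) (proj₂ (inverse x x≉0))

    isolate : ∀ {a d x y s} → d * a ≈ 1# → x ≈ a * y + s → y ≈ d * x + - d * s
    isolate {a} {d} {x} {y} {s} da≈1 x≈ay+s = sym (begin
      d * x + - d * s                 ≈⟨ +-congʳ (*-congˡ x≈ay+s) ⟩
      d * (a * y + s) + - d * s       ≈⟨ +-congʳ (distribˡ d (a * y) s) ⟩
      (d * (a * y) + d * s) + - d * s ≈⟨ +-assoc (d * (a * y)) (d * s) (- d * s) ⟩
      d * (a * y) + (d * s + - d * s) ≈⟨ +-congˡ (distribʳ s d (- d)) ⟨
      d * (a * y) + (d + - d) * s     ≈⟨ +-congˡ (trans (*-congʳ (-‿inverseʳ d)) (zeroˡ s)) ⟩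
      d * (a * y) + 0#                ≈⟨ +-identityʳ _ ⟩
      d * (a * y)                     ≈⟨ *-assoc d a y ⟨
      d * a * y                       ≈⟨ *-congʳ da≈1 ⟩
      1# * y                          ≈⟨ *-identityˡ y ⟩
      y                               ∎)

    head≈0⇒¬LinIndep : ∀ {m} (U : Mat (suc m)) → U zero ≈v zeroV → ¬ LinIndep U
    head≈0⇒¬LinIndep U U₀≈0 U-indep = 0≉1 (sym (U-indep (1# ∷ λ _ → 0#) a·U≈0 zero))
      where
        a·U≈0 : lincomb (1# ∷ λ _ → 0#) U ≈v zeroV
        a·U≈0 j = trans (+-cong (trans (*-congˡ (U₀≈0 j)) (zeroʳ 1#)) (lincomb-≈0 (U ∘ suc) (λ _ → refl) j))
                        (+-identityʳ 0#)

    LinIndep-∷ : ∀ {m} {C : Mat m} {v} → LinIndep C → ¬ InSpan C v → LinIndep (v ∷ C)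
    LinIndep-∷ {C = C} {v} C-indep v∉C a a·vC≈0 with a zero ≟ 0#
    ... | yes a₀≈0 = λ
      { zero    → a₀≈0
      ; (suc i) → C-indep (a ∘ suc) (λ j → trans (sym (lincomb-∷-head≈0 a v C a₀≈0 j)) (a·vC≈0 j)) i }
    ... | no a₀≉0 = ⊥-elim (v∉C ((λ i → - d * a (suc i)) , λ j → begin
      v j                                  ≈⟨ isolate da₀≈1 (sym (a·vC≈0 j)) ⟩
      d * 0# + - d * lincomb (a ∘ suc) C j ≈⟨ +-congʳ (zeroʳ d) ⟩
      0# + - d * lincomb (a ∘ suc) C j     ≈⟨ +-identityˡ _ ⟩
      - d * lincomb (a ∘ suc) C j          ≈⟨ lincomb-* (a ∘ suc) (- d) C j ⟨
      lincomb (λ i → - d * a (suc i)) C j  ∎))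
      where
        d = proj₁ (inverseˡ a₀≉0)
        da₀≈1 = proj₂ (inverseˡ a₀≉0)

    InSpan-exchange : ∀ {m} {M : Mat m} {w c} → ¬ InSpan M c → InSpan (w ∷ M) c → InSpan (c ∷ M) w
    InSpan-exchange {M = M} {w} {c} c∉M (a , c≈) with a zero ≟ 0#
    ... | yes a₀≈0 = ⊥-elim (c∉M (a ∘ suc , λ j → trans (c≈ j) (lincomb-∷-head≈0 a w M a₀≈0 j)))
    ... | no a₀≉0 = (d ∷ λ i → - d * a (suc i)) , λ j →
      trans (isolate da₀≈1 (c≈ j)) (+-congˡ (sym (lincomb-* (a ∘ suc) (- d) M j)))
      where
        d = proj₁ (inverseˡ a₀≉0)
        da₀≈1 = proj₂ (inverseˡ a₀≉0)

    steinitz : ∀ {m} {G : Mat m} (U : Mat (suc m)) → U ⊆span G → ¬ LinIndep U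
    steinitz {zero}      U U⊆G = head≈0⇒¬LinIndep U (proj₂ (U⊆G _ (InSpan-row U zero)))
    steinitz {suc m} {G} U U⊆G U-indep with U⊆G _ (InSpan-row U zero)
    ... | c , U₀≈ with all? (λ j → c j ≟ 0#)
    ...   | yes c≈0 = head≈0⇒¬LinIndep U (λ j → trans (U₀≈ j) (lincomb-≈0 G c≈0 j)) U-indep
    ...   | no c≉0 with ¬∀⟶∃¬ _ _ (λ j → c j ≟ 0#) c≉0
    ...     | j₀ , cⱼ₀≉0 with inverseˡ cⱼ₀≉0
    ...       | d , dc≈1 = steinitz U' U'⊆G' (LinIndep-shear {U = U} t U-indep)
      where
        -- one step of Gaussian elimination: with U zero as pivot row, clear the
        -- j₀-th coordinate (w.r.t. G) of the other rows, which removes generator j₀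
        row : ∀ i → InSpan G (U (suc i))
        row i = U⊆G _ (InSpan-row U (suc i))
        t : Fin (suc m) → Carrier
        t i = - (proj₁ (row i) j₀ * d)
        U' : Mat (suc m)
        U' i j = U (suc i) j + t i * U zero j
        U'⊆G' : U' ⊆span removeAt G j₀
        U'⊆G' = ⊆span-rows λ i → InSpan-eliminate G j₀ {c = c} {e = proj₁ (row i)} dc≈1 U₀≈ (proj₂ (row i))

module FiniteFieldCodes {c ℓ} {F : CommutativeRing c ℓ} {q} (FF : IsFiniteField F q) (n : ℕ) where
  open CommutativeRing F hiding (zero)
  open IsFiniteField FF
  open Codes F n
  open LinearAlgebra F n
  open OverField _≟_ 0≉1 inverse

  ∃-coefficients? : ∀ {p} m {Q : (Fin m → Carrier) → Set p} →
    (∀ {a b} → (∀ i → a i ≈ b i) → Q a → Q b) → (∀ a → Dec (Q a)) → Dec (∃ Q)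
  ∃-coefficients? zero    resp Q? = map′ (_ ,_) (λ (a , Qa) → resp (λ ()) Qa) (Q? (λ ()))
  ∃-coefficients? (suc m) resp Q? = map′
    (λ (x , a , Qxa) → enum x ∷ a , Qxa)
    (λ (a , Qa) → let x , x≈a₀ = enum-surjective (a zero) in
      x , a ∘ suc , resp (λ { zero → sym x≈a₀ ; (suc i) → refl }) Qa)
    (any? λ x → ∃-coefficients? m (λ a≈b → resp λ { zero → refl ; (suc i) → a≈b i })
                                   (λ a → Q? (enum x ∷ a)))

  InSpan? : ∀ {m} (G : Mat m) v → Dec (InSpan G v)
  InSpan? {m} G v = ∃-coefficients? m (λ a≈b v≈ j → trans (v≈ j) (lincomb-cong G a≈b j))
                                     (λ a → all? λ j → v j ≟ lincomb a G j)

  ⊆span? : ∀ {m m'} (G : Mat m) (H : Mat m') → Dec (G ⊆span H)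
  ⊆span? G H = map′ ⊆span-rows (λ G⊆H i → G⊆H _ (InSpan-row G i)) (all? λ i → InSpan? H (G i))

  ¬⊆span⇒∃row : ∀ {m m'} {G : Mat m} {H : Mat m'} → ¬ G ⊆span H → ∃ λ i → ¬ InSpan H (G i)
  ¬⊆span⇒∃row {G = G} {H} G⊈H = ¬∀⟶∃¬ _ _ (λ i → InSpan? H (G i)) (G⊈H ∘ ⊆span-rows)

  LinIndep-⊆span⇒⊇span : ∀ {m} {C G : Mat m} → LinIndep C → C ⊆span G → G ⊆span C
  LinIndep-⊆span⇒⊇span {m} {C} {G} C-indep C⊆G = ⊆span-rows row
    where
      row : ∀ i → InSpan C (G i)
      row i with InSpan? C (G i)
      ... | yes Gᵢ∈C = Gᵢ∈C
      ... | no  Gᵢ∉C = ⊥-elim (steinitz (G i ∷ C) (∷-⊆span (InSpan-row G i) C⊆G) (LinIndep-∷ {C = C} C-indep Gᵢ∉C))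

  ∃-row-outside-span : ∀ {m} (G : Mat (suc m)) → LinIndep G → (C : Mat m) → ∃ λ i → ¬ InSpan C (G i)
  ∃-row-outside-span G G-indep C = ¬⊆span⇒∃row λ G⊆C → steinitz G G⊆C G-indep

  Star-isClique : ∀ {m} {M : Mat m} → LinIndep M → IsClique (Star (suc m) M)
  Star-isClique {m} {M} M-indep X Y M⊆X M⊆Y X≉Y =
    X≉Y , M , M-indep , (λ v v∈M → M⊆X v v∈M , M⊆Y v v∈M) , X∩Y⊆M
    where
      X∩Y⊆M : ∀ v → InSpan (gen X) v → InSpan (gen Y) v → InSpan M v
      X∩Y⊆M v v∈X v∈Y with InSpan? M v
      ... | yes v∈M = v∈M
      ... | no  v∉M = ⊥-elim (X≉Y (X⊆Y , Y⊆X))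
        where
          vM-indep : LinIndep (v ∷ M)
          vM-indep = LinIndep-∷ {C = M} M-indep v∉M
          vM⊆ : ∀ Z → Star (suc m) M Z → InSpan (gen Z) v → (v ∷ M) ⊆span gen Z
          vM⊆ Z M⊆Z v∈Z = ∷-⊆span {G = M} {H = gen Z} v∈Z M⊆Z
          X⊆vM : gen X ⊆span (v ∷ M)
          X⊆vM = LinIndep-⊆span⇒⊇span {C = v ∷ M} {G = gen X} vM-indep (vM⊆ X M⊆X v∈X)
          Y⊆vM : gen Y ⊆span (v ∷ M)
          Y⊆vM = LinIndep-⊆span⇒⊇span {C = v ∷ M} {G = gen Y} vM-indep (vM⊆ Y M⊆Y v∈Y)
          X⊆Y : gen X ⊆span gen Y
          X⊆Y u = vM⊆ Y M⊆Y v∈Y u ∘ X⊆vM u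
          Y⊆X : gen Y ⊆span gen X
          Y⊆X u = vM⊆ X M⊆X v∈X u ∘ Y⊆vM u

  IntersectionDim⇒∃outside : ∀ {m m₁ m₂} {G : Mat m₁} {H : Mat m₂} (M : Mat m) →
    IntersectionDim m G H → ¬ M ⊆span G → ∃ λ v → InSpan G v × InSpan H v × ¬ InSpan M v
  IntersectionDim⇒∃outside M (C , C-indep , C⊆G∩H , _) M⊈G with ⊆span? C M
  ... | yes C⊆M = ⊥-elim (M⊈G λ v → proj₁ ∘ C⊆G∩H v ∘ LinIndep-⊆span⇒⊇span {C = C} {G = M} C-indep C⊆M v)
  ... | no  C⊈M = C i , proj₁ Cᵢ∈G∩H , proj₂ Cᵢ∈G∩H , Cᵢ∉M
    where
      i = proj₁ (¬⊆span⇒∃row C⊈M)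
      Cᵢ∉M = proj₂ (¬⊆span⇒∃row C⊈M)
      Cᵢ∈G∩H = C⊆G∩H _ (InSpan-row C i)

  IntersectionDim⇒⊆span-∷ : ∀ {m m'} {G : Mat (suc m)} {H : Mat m'} → LinIndep G →
    IntersectionDim m G H → ∃ λ z → G ⊆span (z ∷ H)
  IntersectionDim⇒⊆span-∷ {G = G} {H} G-indep (C , C-indep , C⊆G∩H , _) =
    G i , λ v → ∷-mono-⊆span {G = C} {H = H} (λ u → proj₂ ∘ C⊆G∩H u) v ∘ G⊆GᵢC v
    where
      i = proj₁ (∃-row-outside-span G G-indep C)
      Gᵢ∉C : ¬ InSpan C (G i)
      Gᵢ∉C = proj₂ (∃-row-outside-span G G-indep C)
      G⊆GᵢC : G ⊆span (G i ∷ C)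
      G⊆GᵢC = LinIndep-⊆span⇒⊇span {C = G i ∷ C} {G = G} (LinIndep-∷ {C = C} C-indep Gᵢ∉C)
                (∷-⊆span {G = C} {H = G} (InSpan-row G i) (λ u → proj₁ ∘ C⊆G∩H u))

  IntersectionDim⇒∃exchange : ∀ {m m₁ m₂} {G : Mat m₁} {X : Mat m₂} (M : Mat m) {w} →
    IntersectionDim m G X → ¬ M ⊆span G → X ⊆span (w ∷ M) → ∃ λ y → InSpan G y × InSpan (y ∷ M) w
  IntersectionDim⇒∃exchange {G = G} {X} M G∩X M⊈G X⊆wM =
    let y , y∈G , y∈X , y∉M = IntersectionDim⇒∃outside {G = G} {H = X} M G∩X M⊈G
    in y , y∈G , InSpan-exchange y∉M (X⊆wM y y∈X)

  Star-isMaximal : ∀ {m} (M : Mat m) (T : Vec → Set (c ⊔ ℓ)) → (∀ w → T w → ExtendsToStarCode M w) →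
    (B : Mat 3) → LinIndep (B ++ M) → (∀ s → InSpanOf T (B s)) →
    ∀ (D : VSet (suc m)) → IsClique D → (∀ X → Star (suc m) M X → D X) → ∀ Z → D Z → Star (suc m) M Z
  Star-isMaximal {m} M T T⇒code B BM-indep B⊆⟨T⟩ D D-clique Star⊆D Z Z∈D with ⊆span? M (gen Z)
  ... | yes M⊆Z = M⊆Z
  ... | no  M⊈Z = ⊥-elim (steinitz {G = H} (B ++ M) BM⊆H BM-indep)
    where
      meets : ∀ X → Star (suc m) M X → IntersectionDim m (gen Z) (gen X)
      meets X M⊆X = proj₂ (D-clique Z X Z∈D (Star⊆D X M⊆X) λ (_ , X⊆Z) → M⊈Z λ v → X⊆Z v ∘ M⊆X v)

      w₀∈T : ∃ T
      w₀∈T with B⊆⟨T⟩ zero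
      ... | zero  , _ , _   , _ , B₀≈0 = ⊥-elim (head≈0⇒¬LinIndep (B ++ M) B₀≈0 BM-indep)
      ... | suc _ , U , U⊆T , _      = U zero , U⊆T zero

      w₀ = proj₁ w₀∈T
      code₀ = T⇒code w₀ (proj₂ w₀∈T)
      X₀ = proj₁ code₀
      M⊆X₀ = proj₁ (proj₂ code₀)
      X₀⊆w₀M = proj₂ (proj₂ code₀)
      z,Z⊆zX₀ : ∃ λ z → gen Z ⊆span (z ∷ gen X₀)
      z,Z⊆zX₀ = IntersectionDim⇒⊆span-∷ {G = gen Z} {H = gen X₀} (indep Z) (meets X₀ M⊆X₀)
      z = proj₁ z,Z⊆zX₀
      Z⊆zX₀ = proj₂ z,Z⊆zX₀

      H : Mat (suc (suc m))
      H = z ∷ w₀ ∷ M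
      M⊆H : M ⊆span H
      M⊆H v = ⊆span-∷ {G = w₀ ∷ M} {z} v ∘ ⊆span-∷ {G = M} {w₀} v
      Z⊆H : gen Z ⊆span H
      Z⊆H v = ∷-mono-⊆span {G = gen X₀} {H = w₀ ∷ M} X₀⊆w₀M v ∘ Z⊆zX₀ v
      T⊆H : ∀ w → T w → InSpan H w
      T⊆H w w∈T =
        let X , M⊆X , X⊆wM = T⇒code w w∈T
            y , y∈Z , w∈yM = IntersectionDim⇒∃exchange {G = gen Z} {X = gen X} M (meets X M⊆X) M⊈Z X⊆wM
        in ∷-⊆span {G = M} {H = H} (Z⊆H y y∈Z) M⊆H w w∈yM
      B⊆H : B ⊆span H
      B⊆H = ⊆span-rows {G = B} {H = H} λ s → let _ , U , U⊆T , B∈U = B⊆⟨T⟩ s in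
        ⊆span-rows {G = U} {H = H} (λ i → T⊆H _ (U⊆T i)) _ B∈U
      BM⊆H : (B ++ M) ⊆span H
      BM⊆H = ++-⊆span {G = B} {H = M} {K = H} B⊆H M⊆H

module IdentityPrefixed {c ℓ} (F : CommutativeRing c ℓ) {n k₁ : ℕ} (M : Codes.Mat F n k₁)
                        (M-prefix : Codes.IdentityPrefix F n (suc k₁) M) (k₁≤n : k₁ ℕ.≤ n) where
  open CommutativeRing F hiding (zero)
  open Codes F n
  open LinearAlgebra F n

  pivot : Fin k₁ → Fin n
  pivot i = inject≤ i k₁≤n

  pivot<k₁ : ∀ i → toℕ (pivot i) < k₁
  pivot<k₁ i = ≡.subst (_< k₁) (≡.sym (toℕ-inject≤ i k₁≤n)) (toℕ<n i)

  pivot-unitColumn : ∀ i → IsUnitColumn M i (pivot i)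
  pivot-unitColumn i =
    proj₁ (M-prefix i (pivot i) (pivot<k₁ i)) (≡.sym (toℕ-inject≤ i k₁≤n)) ,
    λ i' i'≢i → proj₂ (M-prefix i' (pivot i) (pivot<k₁ i))
                  (λ i'≡i → i'≢i (toℕ-injective (≡.trans i'≡i (toℕ-inject≤ i k₁≤n))))

  ⟨W⟩-pivot≈0 : ∀ {v} → InSpanOf (WSet (suc k₁) M) v → ∀ i → v (pivot i) ≈ 0#
  ⟨W⟩-pivot≈0 (_ , U , U⊆W , v∈U) i =
    InSpan-zeroColumn U (λ i' → proj₁ (U⊆W i') (pivot i) (pivot<k₁ i)) v∈U

  W⇒ExtendsToStarCode : ∀ {w} → WSet (suc k₁) M w → ExtendsToStarCode M w
  W⇒ExtendsToStarCode {w} (_ , G , G-indep , G-proj , G⊆A , A⊆G) =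
    mkCode G G-indep G-proj ,
    (λ v → A⊆G v ∘ proj₂ A≈wM v ∘ ⊆span-∷ {G = M} {w} v) ,
    (λ v → proj₁ A≈wM v ∘ G⊆A v)
    where
      A≈wM = appendRow-SameSpan-∷ M w

lemma1 : ∀ {c ℓ} (F : CommutativeRing c ℓ) (q : ℕ) → IsFiniteField F q →
    ∀ (n k : ℕ) → 1 < k → k < n ∸ 1 →
    ∀ (M : Codes.Mat F n (k ∸ 1)) → Codes.IdentityPrefix F n k M →
    Codes.DimSpanGreaterThan2 F n (Codes.WSet F n k M) →
    Codes.IsMaximalClique F n (Codes.Star F n k M)
lemma1 F q FF n zero ()
lemma1 F q FF n (suc k₁) _ k<n∸1 M M-prefix (B , B-indep , B⊆⟨W⟩) =
  Star-isClique (unitColumns⇒LinIndep pivot pivot-unitColumn) ,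
  Star-isMaximal M (WSet (suc k₁) M) (λ _ → W⇒ExtendsToStarCode) B
    (LinIndep-++-unitColumns {B = B} pivot pivot-unitColumn B-indep (λ s → ⟨W⟩-pivot≈0 (B⊆⟨W⟩ s))) B⊆⟨W⟩
  where
    open Codes F n using (WSet)
    open LinearAlgebra F n using (unitColumns⇒LinIndep; LinIndep-++-unitColumns)
    open FiniteFieldCodes FF n using (Star-isClique; Star-isMaximal)
    -- of the bounds on k only k ≥ 1 and k - 1 ≤ n are needed
    open IdentityPrefixed F M M-prefix (≤-trans (n≤1+n k₁) (≤-trans (<⇒≤ k<n∸1) (m∸n≤m n 1)))
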